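{- Let $n\ge 5$ and let $T$ be an $n$-tournament. Then either $\delta_T=0$, or $n-3\le\delta_T\le\frac{2}{5}\binom{n}{4}$.
   Context: A tournament is a directed graph with exactly one arc between each pair of distinct vertices; an $n$-tournament has $n$ vertices. A diamond is a 4-tournament consisting of a directed 3-cycle together with a vertex that either dominates all three cycle vertices or is dominated by all three; $\delta_T$ is the number of 4-vertex subsets of $V(T)$ whose induced subtournament is a diamond. -}

module Defs where

open import Data.Bool using (Bool; true; false; _∧_; _∨_; not; if_then_else_)
open import Data.Nat using (ℕ; zero; suc; _+_; _<_)
open import Data.Fin using (Fin; toℕ)
open import Data.List using (List; map; allFin)
open import Data.Nat.ListAction using (sum)
open import Relation.Binary.PropositionalEquality using (_≡_; _≢_)
open import Data.Nat using (_<ᵇ_)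

record Tournament (n : ℕ) : Set where
  field
    beats      : Fin n → Fin n → Bool
    irreflexive : ∀ u → beats u u ≡ false
    oneArc     : ∀ u v → u ≢ v → beats u v ≡ not (beats v u)

open Tournament public

module _ {n : ℕ} (T : Tournament n) where

  private
    _⇒_ : Fin n → Fin n → Bool
    u ⇒ v = beats T u v

  isCyclic3 : Fin n → Fin n → Fin n → Bool
  isCyclic3 x y z = ((x ⇒ y) ∧ (y ⇒ z) ∧ (z ⇒ x)) ∨ ((y ⇒ x) ∧ (z ⇒ y) ∧ (x ⇒ z))

  isApex : Fin n → Fin n → Fin n → Fin n → Bool
  isApex v x y z = ((v ⇒ x) ∧ (v ⇒ y) ∧ (v ⇒ z)) ∨ ((x ⇒ v) ∧ (y ⇒ v) ∧ (z ⇒ v))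

  isDiamond : Fin n → Fin n → Fin n → Fin n → Bool
  isDiamond a b c d =
       (isApex a b c d ∧ isCyclic3 b c d)
    ∨ (isApex b a c d ∧ isCyclic3 a c d)
    ∨ (isApex c a b d ∧ isCyclic3 a b d)
    ∨ (isApex d a b c ∧ isCyclic3 a b c)

  private
    _<?_ : Fin n → Fin n → Bool
    u <? v = toℕ u <ᵇ toℕ v

    quad : Fin n → Fin n → Fin n → Fin n → ℕ
    quad a b c d =
      if (a <? b) ∧ (b <? c) ∧ (c <? d) ∧ isDiamond a b c d then 1 else 0

  δ : ℕ
  δ = sum (map (λ a → sum (map (λ b → sum (map (λ c → sum (map (λ d →
        quad a b c d) (allFin n))) (allFin n))) (allFin n))) (allFin n))

-- Every tournament on five vertices spans either 0 or 2 diamonds; this is checked over the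
-- 2¹⁰ orientations of the ten arcs above the diagonal. Counting pairs (diamond, 5-set
-- containing it) gives (n − 4) δ_T ≤ 2 C(n,5) = 2 (n − 4) C(n,4) / 5, the upper bound.
-- For the lower bound take a diamond W and a vertex v ∉ W: W is still a diamond of T − v,
-- while the other diamond inside W ∪ {v} contains v, so δ_T ≥ δ_{T−v} + 1, and induction on
-- n gives δ_T ≥ n − 3 (trivially so while n ≤ 4).
module Submission where

open import Defs
open import Data.Nat using (ℕ; _≤_; _*_; _∸_)
open import Data.Nat.Combinatorics using (_C_)
open import Data.Product using (_×_)
open import Data.Sum using (_⊎_)
open import Relation.Binary.PropositionalEquality using (_≡_)

open import Data.Bool using (Bool; true; false; _∧_; _∨_; not; if_then_else_) renaming (T to IsTrue)
open import Data.Bool.Properties using (not-involutive; T-∧)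
open import Data.Fin as Fin using (Fin; zero; suc; toℕ; punchIn)
open import Data.Fin.Patterns using (0F; 1F; 2F; 3F; 4F)
open import Data.Fin.Properties using (<-cmp; <-irrefl; <-asym; punchIn-injective; punchInᵢ≢i; suc-injective)
import Data.List as List
open import Data.Nat using (zero; suc; _+_; _<_; _<ᵇ_; z≤n; s≤s; _≟_; _≤?_; >-nonZero)
open import Data.Nat.Combinatorics using (nCk+nC[k+1]≡[n+1]C[k+1])
import Data.Nat.ListAction as ListAction
open import Data.Nat.Properties
  using ( ≤-refl; ≤-trans; ≤-reflexive; n≤1+n; m≤n⇒m≤1+n; m≤m+n; m≤n+m; n≤0⇒n≡0; n≢0⇒n>0; ≰⇒>
        ; +-assoc; +-identityʳ; *-identityˡ; *-identityʳ; *-zeroʳ; *-distribˡ-+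
        ; +-mono-≤; +-monoˡ-≤; *-monoʳ-≤; *-cancelˡ-≤; ∸-monoˡ-≤; +-∸-assoc; m<n⇒0<n∸m
        ; +-0-commutativeMonoid; +-commutativeSemigroup; *-commutativeSemigroup; module ≤-Reasoning )
open import Algebra.Properties.CommutativeMonoid.Sum +-0-commutativeMonoid
  using (sum; sum-cong-≗; sum-replicate-zero; sum-remove)
open import Algebra.Properties.CommutativeSemigroup +-commutativeSemigroup
  using (interchange; x∙yz≈y∙xz)
open import Algebra.Properties.CommutativeSemigroup *-commutativeSemigroup
  using () renaming (x∙yz≈y∙xz to m*[n*o]≡n*[m*o])
open import Data.Nat.Tactic.RingSolver using (solve-∀)
open import Data.Product using (∃-syntax; _,_; proj₁; proj₂)
open import Data.Sum using (inj₁; inj₂)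
open import Data.Unit using (tt)
open import Data.Vec using (Vec; []; _∷_; map; lookup; removeAt; insertAt; allFin)
open import Data.Vec.Properties
  using (map-∘; lookup-map; removeAt-punchOut; map-insertAt; removeAt-insertAt; insertAt-lookup)
open import Data.Vec.Membership.Propositional using (_∈_; _∉_)
open import Data.Vec.Membership.Propositional.Properties using (∈-lookup)
open import Data.Vec.Relation.Unary.Any using (here; there)
open import Function using (_∘_; Equivalence)
open import Function.Definitions using (Injective)
open import Relation.Binary.Definitions using (tri<; tri≈; tri>)
open import Relation.Binary.PropositionalEquality
  using (_≢_; refl; sym; trans; cong; cong₂; subst; module ≡-Reasoning)
open import Relation.Nullary using (Dec; yes; no; contradiction)
open import Relation.Nullary.Decidable using (_⊎-dec_; isYes; toWitness)

indicator : Bool → ℕ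
indicator b = if b then 1 else 0

indicator≤1 : ∀ b → indicator b ≤ 1
indicator≤1 true  = ≤-refl
indicator≤1 false = z≤n

term≤sum : ∀ {m} (f : Fin m → ℕ) i → f i ≤ sum f
term≤sum f zero    = m≤m+n _ _
term≤sum f (suc i) = ≤-trans (term≤sum (f ∘ suc) i) (m≤n+m _ _)

sum≢0⇒term≢0 : ∀ {m} (f : Fin m → ℕ) → sum f ≢ 0 → ∃[ i ] f i ≢ 0
sum≢0⇒term≢0 {zero}  f Σ≢0 = contradiction refl Σ≢0
sum≢0⇒term≢0 {suc m} f Σ≢0 with f zero ≟ 0
... | no  f₀≢0 = zero , f₀≢0
... | yes f₀≡0 with sum≢0⇒term≢0 (f ∘ suc) (λ Σ≡0 → Σ≢0 (cong₂ _+_ f₀≡0 Σ≡0))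
...   | i , fᵢ≢0 = suc i , fᵢ≢0

listSum-map-tabulate : ∀ {A : Set} {m} (f : A → ℕ) (g : Fin m → A) →
  ListAction.sum (List.map f (List.tabulate g)) ≡ sum (f ∘ g)
listSum-map-tabulate {m = zero}  f g = refl
listSum-map-tabulate {m = suc m} f g = cong (f (g zero) +_) (listSum-map-tabulate f (g ∘ suc))

listTupleSum : ∀ k m → (Vec (Fin m) k → ℕ) → ℕ
listTupleSum zero    m h = h []
listTupleSum (suc k) m h =
  ListAction.sum (List.map (λ a → listTupleSum k m (h ∘ (a ∷_))) (List.allFin m))

tupleSum : ∀ k m → (Vec (Fin m) k → ℕ) → ℕ
tupleSum zero    m h = h []
tupleSum (suc k) m h = sum (λ a → tupleSum k m (h ∘ (a ∷_)))

listTupleSum≡tupleSum : ∀ k m h → listTupleSum k m h ≡ tupleSum k m h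
listTupleSum≡tupleSum zero    m h = refl
listTupleSum≡tupleSum (suc k) m h =
  trans (listSum-map-tabulate (λ a → listTupleSum k m (h ∘ (a ∷_))) (λ a → a))
        (sum-cong-≗ (λ a → listTupleSum≡tupleSum k m (h ∘ (a ∷_))))

tupleSum-zero : ∀ k m → tupleSum k m (λ _ → 0) ≡ 0
tupleSum-zero zero    m = refl
tupleSum-zero (suc k) m =
  trans (sum-cong-≗ {m} (λ _ → tupleSum-zero k m)) (sum-replicate-zero m)

-- The sum of h over the strictly increasing k-tuples of Fin m, i.e. over the k-subsets.
subsetSum : ∀ k m → (Vec (Fin m) k → ℕ) → ℕ
subsetSum zero    m       h = h []
subsetSum (suc k) zero    h = 0
subsetSum (suc k) (suc m) h =
  subsetSum k m (λ v → h (zero ∷ map suc v)) + subsetSum (suc k) m (h ∘ map suc)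

data Increasing : ∀ {k m} → Vec (Fin m) k → Set where
  []     : ∀ {m} → Increasing {0} {m} []
  zero∷_ : ∀ {k m} {v : Vec (Fin m) k} → Increasing v → Increasing (zero ∷ map suc v)
  ↑_     : ∀ {k m} {v : Vec (Fin m) k} → Increasing v → Increasing (map suc v)

subsetSum-cong : ∀ k m {g h : Vec (Fin m) k → ℕ} → (∀ v → g v ≡ h v) →
                 subsetSum k m g ≡ subsetSum k m h
subsetSum-cong zero    m       g≗h = g≗h []
subsetSum-cong (suc k) zero    g≗h = refl
subsetSum-cong (suc k) (suc m) g≗h =
  cong₂ _+_ (subsetSum-cong k m (g≗h ∘ _)) (subsetSum-cong (suc k) m (g≗h ∘ map suc))

subsetSum-mono : ∀ k m {g h : Vec (Fin m) k → ℕ} → (∀ {v} → Increasing v → g v ≤ h v) →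
                 subsetSum k m g ≤ subsetSum k m h
subsetSum-mono zero    m       g≤h = g≤h []
subsetSum-mono (suc k) zero    g≤h = z≤n
subsetSum-mono (suc k) (suc m) g≤h =
  +-mono-≤ (subsetSum-mono k m (g≤h ∘ zero∷_)) (subsetSum-mono (suc k) m (g≤h ∘ ↑_))

term≤subsetSum : ∀ {k m} (h : Vec (Fin m) k → ℕ) {v} → Increasing v → h v ≤ subsetSum k m h
term≤subsetSum h []                       = ≤-refl
term≤subsetSum h (zero∷ inc)              = ≤-trans (term≤subsetSum _ inc) (m≤m+n _ _)
term≤subsetSum {zero}  h (↑_ {v = []} inc) = ≤-refl
term≤subsetSum {suc k} h (↑ inc)          = ≤-trans (term≤subsetSum _ inc) (m≤n+m _ _)

subsetSum≢0⇒term≢0 : ∀ k m (h : Vec (Fin m) k → ℕ) → subsetSum k m h ≢ 0 →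
                     ∃[ v ] Increasing v × h v ≢ 0
subsetSum≢0⇒term≢0 zero    m       h Σ≢0 = [] , [] , Σ≢0
subsetSum≢0⇒term≢0 (suc k) zero    h Σ≢0 = contradiction refl Σ≢0
subsetSum≢0⇒term≢0 (suc k) (suc m) h Σ≢0
  with subsetSum k m (λ v → h (zero ∷ map suc v)) ≟ 0
... | no Σ₀≢0 with subsetSum≢0⇒term≢0 k m _ Σ₀≢0
...   | v , inc , hv≢0 = zero ∷ map suc v , zero∷ inc , hv≢0
subsetSum≢0⇒term≢0 (suc k) (suc m) h Σ≢0
    | yes Σ₀≡0 with subsetSum≢0⇒term≢0 (suc k) m (h ∘ map suc) (λ Σ₁≡0 → Σ≢0 (cong₂ _+_ Σ₀≡0 Σ₁≡0))
...   | v , inc , hv≢0 = map suc v , ↑ inc , hv≢0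

subsetSum-+ : ∀ k m (g h : Vec (Fin m) k → ℕ) →
              subsetSum k m (λ v → g v + h v) ≡ subsetSum k m g + subsetSum k m h
subsetSum-+ zero    m       g h = refl
subsetSum-+ (suc k) zero    g h = refl
subsetSum-+ (suc k) (suc m) g h = begin
  subsetSum k m (λ v → g (zero ∷ map suc v) + h (zero ∷ map suc v))
    + subsetSum (suc k) m (λ v → g (map suc v) + h (map suc v))
    ≡⟨ cong₂ _+_ (subsetSum-+ k m _ _) (subsetSum-+ (suc k) m _ _) ⟩
  (G₀ + H₀) + (G₁ + H₁)
    ≡⟨ interchange G₀ H₀ G₁ H₁ ⟩
  (G₀ + G₁) + (H₀ + H₁) ∎
  where
  open ≡-Reasoning
  G₀ = subsetSum k m (λ v → g (zero ∷ map suc v))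
  H₀ = subsetSum k m (λ v → h (zero ∷ map suc v))
  G₁ = subsetSum (suc k) m (g ∘ map suc)
  H₁ = subsetSum (suc k) m (h ∘ map suc)

subsetSum-const : ∀ k m c → subsetSum k m (λ _ → c) ≡ c * (m C k)
subsetSum-const zero    m       c = sym (*-identityʳ c)
subsetSum-const (suc k) zero    c = sym (*-zeroʳ c)
subsetSum-const (suc k) (suc m) c = begin
  subsetSum k m (λ _ → c) + subsetSum (suc k) m (λ _ → c)
    ≡⟨ cong₂ _+_ (subsetSum-const k m c) (subsetSum-const (suc k) m c) ⟩
  c * (m C k) + c * (m C suc k)   ≡⟨ *-distribˡ-+ c (m C k) _ ⟨
  c * (m C k + m C suc k)         ≡⟨ cong (c *_) (nCk+nC[k+1]≡[n+1]C[k+1] m k) ⟩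
  c * (suc m C suc k)             ∎
  where open ≡-Reasoning

subsetSum-vanishes : ∀ k m (h : Vec (Fin m) k → ℕ) → m < k → subsetSum k m h ≡ 0
subsetSum-vanishes (suc k) zero    h m<k       = refl
subsetSum-vanishes (suc k) (suc m) h (s≤s m<k) =
  cong₂ _+_ (subsetSum-vanishes k m _ m<k) (subsetSum-vanishes (suc k) m _ (m≤n⇒m≤1+n m<k))

-- ∂ h u sums h over the facets of u, the tuples obtained by deleting one entry.
∂ : ∀ {A : Set} {k} → (Vec A k → ℕ) → Vec A (suc k) → ℕ
∂ {k = zero}  h (x ∷ []) = h []
∂ {k = suc k} h (x ∷ v)  = h v + ∂ (h ∘ (x ∷_)) v

∂-map : ∀ {A B : Set} {k} (f : A → B) (h : Vec B k → ℕ) v → ∂ h (map f v) ≡ ∂ (h ∘ map f) v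
∂-map {k = zero}  f h (x ∷ []) = refl
∂-map {k = suc k} f h (x ∷ v)  = cong (h (map f v) +_) (∂-map f (h ∘ (f x ∷_)) v)

∂-const : ∀ {A : Set} {k} c (u : Vec A (suc k)) → ∂ (λ _ → c) u ≡ suc k * c
∂-const {k = zero}  c (x ∷ []) = sym (+-identityʳ c)
∂-const {k = suc k} c (x ∷ v)  = cong (c +_) (∂-const c v)

∂-cong : ∀ {A : Set} {k} {g h : Vec A k → ℕ} → (∀ v → g v ≡ h v) → ∀ u → ∂ g u ≡ ∂ h u
∂-cong {k = zero}  g≗h (x ∷ []) = g≗h []
∂-cong {k = suc k} g≗h (x ∷ v)  = cong₂ _+_ (g≗h v) (∂-cong (g≗h ∘ (x ∷_)) v)

∂≡sum-removeAt : ∀ {A : Set} {k} (h : Vec A k → ℕ) (u : Vec A (suc k)) →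
                 ∂ h u ≡ sum (λ j → h (removeAt u j))
∂≡sum-removeAt {k = zero}  h (x ∷ [])    = sym (+-identityʳ (h []))
∂≡sum-removeAt {k = suc k} h (x ∷ y ∷ v) = cong (h (y ∷ v) +_) (∂≡sum-removeAt (h ∘ (x ∷_)) (y ∷ v))

-- Double counting: every k-subset of Fin m is a facet of exactly m ∸ k subsets of size k + 1.
subsetSum-∂ : ∀ k m (h : Vec (Fin m) k → ℕ) → subsetSum (suc k) m (∂ h) ≡ (m ∸ k) * subsetSum k m h
subsetSum-∂ zero    zero    h = refl
subsetSum-∂ (suc k) zero    h = refl
subsetSum-∂ zero    (suc m) h =
  cong (h [] +_) (trans (subsetSum-cong 1 m (∂-map suc h)) (subsetSum-∂ zero m (h ∘ map suc)))
subsetSum-∂ (suc k) (suc m) h = begin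
  subsetSum (suc k) m (λ v → ∂ h (zero ∷ map suc v)) + subsetSum (suc (suc k)) m (∂ h ∘ map suc)
    ≡⟨ cong₂ _+_ (subsetSum-cong (suc k) m (λ v → cong (hₛ v +_) (∂-map suc h₀ v)))
                 (subsetSum-cong (suc (suc k)) m (∂-map suc h)) ⟩
  subsetSum (suc k) m (λ v → hₛ v + ∂ h₀′ v) + subsetSum (suc (suc k)) m (∂ hₛ)
    ≡⟨ cong₂ _+_ (subsetSum-+ (suc k) m hₛ (∂ h₀′)) (subsetSum-∂ (suc k) m hₛ) ⟩
  A + subsetSum (suc k) m (∂ h₀′) + (m ∸ suc k) * A
    ≡⟨ cong (λ x → A + x + (m ∸ suc k) * A) (subsetSum-∂ k m h₀′) ⟩
  A + (m ∸ k) * S + (m ∸ suc k) * A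
    ≡⟨ combine m k (λ m≤k → subsetSum-vanishes (suc k) m hₛ (s≤s m≤k)) ⟩
  (m ∸ k) * (S + A) ∎
  where
  open ≡-Reasoning
  h₀ = h ∘ (zero ∷_)
  h₀′ = h₀ ∘ map suc
  hₛ = h ∘ map suc
  A = subsetSum (suc k) m hₛ
  S = subsetSum k m h₀′
  arith : ∀ a s m → a + suc m * s + m * a ≡ suc m * (s + a)
  arith = solve-∀
  combine : ∀ m k → (m ≤ k → A ≡ 0) → A + (m ∸ k) * S + (m ∸ suc k) * A ≡ (m ∸ k) * (S + A)
  combine zero    zero    A≡0 = cong (λ a → a + 0 + 0) (A≡0 z≤n)
  combine zero    (suc k) A≡0 = cong (λ a → a + 0 + 0) (A≡0 z≤n)
  combine (suc m) zero    _   = arith A S m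
  combine (suc m) (suc k) A≡0 = combine m k (A≡0 ∘ s≤s)

binomial-absorption : ∀ m k → (m ∸ k) * (m C k) ≡ suc k * (m C suc k)
binomial-absorption m k = begin
  (m ∸ k) * (m C k)                    ≡⟨ cong ((m ∸ k) *_) (trans (subsetSum-const k m 1) (*-identityˡ _)) ⟨
  (m ∸ k) * subsetSum k m (λ _ → 1)    ≡⟨ subsetSum-∂ k m (λ _ → 1) ⟨
  subsetSum (suc k) m (∂ (λ _ → 1))    ≡⟨ subsetSum-cong (suc k) m (∂-const 1) ⟩
  subsetSum (suc k) m (λ _ → suc k * 1) ≡⟨ subsetSum-const (suc k) m (suc k * 1) ⟩
  suc k * 1 * (m C suc k)              ≡⟨ cong (_* (m C suc k)) (*-identityʳ (suc k)) ⟩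
  suc k * (m C suc k)                  ∎
  where open ≡-Reasoning

ascending : ∀ {m k} → Fin m → Vec (Fin m) k → Bool → Bool
ascending x []      b = b
ascending x (y ∷ v) b = (toℕ x <ᵇ toℕ y) ∧ ascending y v b

countIfAscending : ∀ {m k} → (Vec (Fin m) (suc k) → Bool) → Vec (Fin m) (suc k) → ℕ
countIfAscending P (a ∷ v) = indicator (ascending a v (P (a ∷ v)))

tupleSum-ascending-suc : ∀ k {m} (x : Fin m) (Q : Vec (Fin (suc m)) k → Bool) →
  tupleSum k (suc m) (λ v → indicator (ascending (suc x) v (Q v))) ≡
  tupleSum k m (λ v → indicator (ascending x v (Q (map suc v))))
tupleSum-ascending-suc zero    x Q = refl
tupleSum-ascending-suc (suc k) {m} x Q = cong₂ _+_ (tupleSum-zero k (suc m)) (sum-cong-≗ after)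
  where
  after : ∀ y →
    tupleSum k (suc m) (λ v → indicator ((toℕ x <ᵇ toℕ y) ∧ ascending (suc y) v (Q (suc y ∷ v)))) ≡
    tupleSum k m (λ v → indicator ((toℕ x <ᵇ toℕ y) ∧ ascending y v (Q (suc y ∷ map suc v))))
  after y with toℕ x <ᵇ toℕ y
  ... | false = trans (tupleSum-zero k (suc m)) (sym (tupleSum-zero k m))
  ... | true  = tupleSum-ascending-suc k y (Q ∘ (suc y ∷_))

tupleSum-countIfAscending : ∀ k m (P : Vec (Fin m) (suc k) → Bool) →
  tupleSum (suc k) m (countIfAscending P) ≡ subsetSum (suc k) m (indicator ∘ P)
tupleSum-countIfAscending-zero∷ : ∀ k m (P : Vec (Fin (suc m)) (suc k) → Bool) →
  tupleSum k (suc m) (countIfAscending P ∘ (zero ∷_)) ≡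
  subsetSum k m (λ v → indicator (P (zero ∷ map suc v)))

tupleSum-countIfAscending k zero    P = refl
tupleSum-countIfAscending k (suc m) P =
  cong₂ _+_ (tupleSum-countIfAscending-zero∷ k m P)
            (trans (sum-cong-≗ (λ a → tupleSum-ascending-suc k a (P ∘ (suc a ∷_))))
                   (tupleSum-countIfAscending k m (P ∘ map suc)))

tupleSum-countIfAscending-zero∷ zero    m P = refl
tupleSum-countIfAscending-zero∷ (suc k) m P =
  cong₂ _+_ (tupleSum-zero k (suc m))
            (trans (sum-cong-≗ (λ a → tupleSum-ascending-suc k a (P ∘ (zero ∷_) ∘ (suc a ∷_))))
                   (tupleSum-countIfAscending k m (P ∘ (zero ∷_) ∘ map suc)))

isDiamondᵛ : ∀ {n} → Tournament n → Vec (Fin n) 4 → Bool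
isDiamondᵛ T (a ∷ b ∷ c ∷ d ∷ []) = isDiamond T a b c d

diamond : ∀ {n} → Tournament n → Vec (Fin n) 4 → ℕ
diamond T = indicator ∘ isDiamondᵛ T

-- Unfolding Defs.δ gives listTupleSum 4 n (countIfAscending (isDiamondᵛ T)) on the nose.
δ≡subsetSum : ∀ {n} (T : Tournament n) → δ T ≡ subsetSum 4 n (diamond T)
δ≡subsetSum {n} T = trans (listTupleSum≡tupleSum 4 n (countIfAscending (isDiamondᵛ T)))
                          (tupleSum-countIfAscending 3 n (isDiamondᵛ T))

map-removeAt : ∀ {A B : Set} {k} (f : A → B) (u : Vec A (suc k)) i →
               removeAt (map f u) i ≡ map f (removeAt u i)
map-removeAt f (x ∷ u)     zero    = refl
map-removeAt f (x ∷ y ∷ u) (suc i) = cong (f x ∷_) (map-removeAt f (y ∷ u) i)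

map-punchIn-suc : ∀ {k m} (v : Fin (suc m)) (u : Vec (Fin m) k) →
                  map (punchIn (suc v)) (map suc u) ≡ map suc (map (punchIn v) u)
map-punchIn-suc v u = trans (sym (map-∘ (punchIn (suc v)) suc u)) (map-∘ suc (punchIn v) u)

lookup∈removeAt : ∀ {A : Set} {k} (u : Vec A (suc k)) {i j} → i ≢ j → lookup u i ∈ removeAt u j
lookup∈removeAt u i≢j = subst (_∈ _) (removeAt-punchOut u (i≢j ∘ sym)) (∈-lookup _ _)

suc∈map-suc⁻ : ∀ {k m} {x : Fin m} (v : Vec (Fin m) k) → suc x ∈ map suc v → x ∈ v
suc∈map-suc⁻ (y ∷ v) (here refl) = here refl
suc∈map-suc⁻ (y ∷ v) (there x∈v) = there (suc∈map-suc⁻ v x∈v)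

zero∉map-suc : ∀ {k m} (v : Vec (Fin m) k) → Fin.zero ∉ map suc v
zero∉map-suc (y ∷ v) (here ())
zero∉map-suc (y ∷ v) (there 0∈v) = zero∉map-suc v 0∈v

Increasing-removeAt : ∀ {k m} {u : Vec (Fin m) (suc k)} → Increasing u → ∀ j → Increasing (removeAt u j)
Increasing-removeAt (zero∷ inc) zero = ↑ inc
Increasing-removeAt (zero∷_ {v = v@(_ ∷ _)} inc) (suc j) =
  subst (Increasing ∘ (zero ∷_)) (sym (map-removeAt suc v j)) (zero∷ Increasing-removeAt inc j)
Increasing-removeAt (↑_ {v = v} inc) j =
  subst Increasing (sym (map-removeAt suc v j)) (↑ Increasing-removeAt inc j)

Increasing⇒lookup-injective : ∀ {k m} {u : Vec (Fin m) k} → Increasing u → Injective _≡_ _≡_ (lookup u)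
Increasing⇒lookup-injective (zero∷ inc)          {zero}  {zero}  _ = refl
Increasing⇒lookup-injective (zero∷_ {v = v} inc) {zero}  {suc j} e with trans e (lookup-map j suc v)
... | ()
Increasing⇒lookup-injective (zero∷_ {v = v} inc) {suc i} {zero}  e with trans (sym e) (lookup-map i suc v)
... | ()
Increasing⇒lookup-injective (zero∷_ {v = v} inc) {suc i} {suc j} e =
  cong suc (Increasing⇒lookup-injective inc (suc-injective
    (trans (sym (lookup-map i suc v)) (trans e (lookup-map j suc v)))))
Increasing⇒lookup-injective (↑_ {v = v} inc) {i} {j} e =
  Increasing⇒lookup-injective inc (suc-injective
    (trans (sym (lookup-map i suc v)) (trans e (lookup-map j suc v))))

subsetSum-punchIn-suc : ∀ k m (v : Fin (suc m)) (h : Vec (Fin (suc (suc m))) (suc k) → ℕ) →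
  subsetSum (suc k) (suc m) (h ∘ map (punchIn (suc v))) ≡
  subsetSum k m ((λ w → h (zero ∷ map suc w)) ∘ map (punchIn v)) +
  subsetSum (suc k) m (h ∘ map suc ∘ map (punchIn v))
subsetSum-punchIn-suc k m v h =
  cong₂ _+_ (subsetSum-cong k m (cong (h ∘ (zero ∷_)) ∘ map-punchIn-suc v))
            (subsetSum-cong (suc k) m (cong h ∘ map-punchIn-suc v))

subsetSum-punchIn≤ : ∀ k m (v : Fin (suc m)) (h : Vec (Fin (suc m)) k → ℕ) →
                     subsetSum k m (h ∘ map (punchIn v)) ≤ subsetSum k (suc m) h
subsetSum-punchIn≤ zero    m       v       h = ≤-refl
subsetSum-punchIn≤ (suc k) m       zero    h = m≤n+m _ _
subsetSum-punchIn≤ (suc k) (suc m) (suc v) h =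
  ≤-trans (≤-reflexive (subsetSum-punchIn-suc k m v h))
          (+-mono-≤ (subsetSum-punchIn≤ k m v (λ w → h (zero ∷ map suc w)))
                    (subsetSum-punchIn≤ (suc k) m v (h ∘ map suc)))

-- The subsets counted on the left are those avoiding v; z contains v.
term+subsetSum-punchIn≤ : ∀ k m (v : Fin (suc m)) (h : Vec (Fin (suc m)) k → ℕ) {z} →
  Increasing z → v ∈ z → h z + subsetSum k m (h ∘ map (punchIn v)) ≤ subsetSum k (suc m) h
term+subsetSum-punchIn≤ (suc k) m zero h (zero∷ inc) _ =
  +-monoˡ-≤ _ (term≤subsetSum (λ w → h (zero ∷ map suc w)) inc)
term+subsetSum-punchIn≤ (suc k) m zero h (↑_ {v = w} inc) 0∈z = contradiction 0∈z (zero∉map-suc w)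
term+subsetSum-punchIn≤ (suc k) (suc m) (suc v) h {z} inc v∈z =
  ≤-trans (≤-reflexive (cong (h z +_) (subsetSum-punchIn-suc k m v h))) (split inc v∈z)
  where
  h₀ = λ w → h (zero ∷ map suc w)
  hₛ = h ∘ map suc
  L₀ = subsetSum k m (h₀ ∘ map (punchIn v))
  L₁ = subsetSum (suc k) m (hₛ ∘ map (punchIn v))
  split : ∀ {z} → Increasing z → suc v ∈ z → h z + (L₀ + L₁) ≤ subsetSum (suc k) (suc (suc m)) h
  split (zero∷_ {v = w} inc) (there v∈z) =
    ≤-trans (≤-reflexive (sym (+-assoc (h₀ w) L₀ L₁)))
            (+-mono-≤ (term+subsetSum-punchIn≤ k m v h₀ inc (suc∈map-suc⁻ w v∈z))
                      (subsetSum-punchIn≤ (suc k) m v hₛ))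
  split (↑_ {v = w} inc) v∈z =
    ≤-trans (≤-reflexive (x∙yz≈y∙xz (hₛ w) L₀ L₁))
            (+-mono-≤ (subsetSum-punchIn≤ k m v h₀)
                      (term+subsetSum-punchIn≤ (suc k) m v hₛ inc (suc∈map-suc⁻ w v∈z)))

record Extension {k m} (w : Vec (Fin (suc m)) k) : Set where
  field
    vertex   : Fin (suc m)
    rest     : Vec (Fin m) k
    rest↑    : Increasing rest
    renumber : map (punchIn vertex) rest ≡ w
    position : Fin (suc k)
    extended↑ : Increasing (insertAt w position vertex)

extend : ∀ {k m} {w : Vec (Fin (suc m)) k} → Increasing w → k ≤ m → Extension w
extend [] _ = record
  { vertex = zero ; rest = [] ; rest↑ = [] ; renumber = refl ; position = zero ; extended↑ = zero∷ [] }
extend (↑_ {v = w} inc) _ = record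
  { vertex = zero ; rest = w ; rest↑ = inc ; renumber = refl ; position = zero ; extended↑ = zero∷ inc }
extend {suc k} {suc m} (zero∷_ {v = w} inc) (s≤s k≤m) = record
  { vertex = suc vertex
  ; rest = zero ∷ map suc rest
  ; rest↑ = zero∷ rest↑
  ; renumber = cong (zero ∷_) (trans (map-punchIn-suc vertex rest) (cong (map suc) renumber))
  ; position = suc position
  ; extended↑ = subst (Increasing ∘ (zero ∷_)) (map-insertAt suc vertex w position) (zero∷ extended↑)
  }
  where open Extension (extend inc k≤m)

induced : ∀ {k m} (T : Tournament m) (f : Fin k → Fin m) → Injective _≡_ _≡_ f → Tournament k
induced T f f-injective = record
  { beats       = λ i j → beats T (f i) (f j)
  ; irreflexive = λ i → irreflexive T (f i)
  ; oneArc      = λ i j i≢j → oneArc T (f i) (f j) (i≢j ∘ f-injective)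
  }

_∖_ : ∀ {m} → Tournament (suc m) → Fin (suc m) → Tournament m
T ∖ v = induced T (punchIn v) (punchIn-injective v _ _)

diamond-∖ : ∀ {m} (T : Tournament (suc m)) v w → diamond (T ∖ v) w ≡ diamond T (map (punchIn v) w)
diamond-∖ T v (a ∷ b ∷ c ∷ d ∷ []) = refl

isDiamond-cong : ∀ {n} {T T′ : Tournament n} → (∀ x y → beats T x y ≡ beats T′ x y) →
                 ∀ a b c d → isDiamond T a b c d ≡ isDiamond T′ a b c d
isDiamond-cong {T = T} {T′} e a b c d =
  cong₂ _∨_ (part a b c d) (cong₂ _∨_ (part b a c d) (cong₂ _∨_ (part c a b d) (part d a b c)))
  where
  ∧³ : ∀ {p q r p′ q′ r′} → p ≡ p′ → q ≡ q′ → r ≡ r′ → p ∧ q ∧ r ≡ p′ ∧ q′ ∧ r′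
  ∧³ p≡ q≡ r≡ = cong₂ _∧_ p≡ (cong₂ _∧_ q≡ r≡)
  part : ∀ v x y z → (isApex T v x y z ∧ isCyclic3 T x y z) ≡ (isApex T′ v x y z ∧ isCyclic3 T′ x y z)
  part v x y z = cong₂ _∧_
    (cong₂ _∨_ (∧³ (e v x) (e v y) (e v z)) (∧³ (e x v) (e y v) (e z v)))
    (cong₂ _∨_ (∧³ (e x y) (e y z) (e z x)) (∧³ (e y x) (e z y) (e x z)))

diamond-cong : ∀ {n} {T T′ : Tournament n} → (∀ x y → beats T x y ≡ beats T′ x y) →
               ∀ v → diamond T v ≡ diamond T′ v
diamond-cong {T = T} {T′} e (a ∷ b ∷ c ∷ d ∷ []) = cong indicator (isDiamond-cong {T = T} {T′} e a b c d)

aboveDiagonal : ∀ {n} → (Fin n → Fin n → Bool) → Fin n → Fin n → Bool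
aboveDiagonal B i j with <-cmp i j
... | tri< _ _ _ = B i j
... | tri≈ _ _ _ = false
... | tri> _ _ _ = not (B j i)

orient : ∀ {n} → (Fin n → Fin n → Bool) → Tournament n
orient B = record { beats = aboveDiagonal B ; irreflexive = irreflexive′ ; oneArc = oneArc′ }
  where
  irreflexive′ : ∀ i → aboveDiagonal B i i ≡ false
  irreflexive′ i with <-cmp i i
  ... | tri< i<i _ _ = contradiction i<i (<-irrefl refl)
  ... | tri≈ _ _ _   = refl
  ... | tri> _ _ i<i = contradiction i<i (<-irrefl refl)
  oneArc′ : ∀ i j → i ≢ j → aboveDiagonal B i j ≡ not (aboveDiagonal B j i)
  oneArc′ i j i≢j with <-cmp i j | <-cmp j i
  ... | tri< _ _ _   | tri> _ _ _   = sym (not-involutive (B i j))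
  ... | tri> _ _ _   | tri< _ _ _   = refl
  ... | tri≈ _ i≡j _ | _            = contradiction i≡j i≢j
  ... | _            | tri≈ _ j≡i _ = contradiction (sym j≡i) i≢j
  ... | tri< i<j _ _ | tri< j<i _ _ = contradiction j<i (<-asym i<j)
  ... | tri> _ _ j<i | tri> _ _ i<j = contradiction j<i (<-asym i<j)

aboveDiagonal-beats : ∀ {n} (T : Tournament n) i j → aboveDiagonal (beats T) i j ≡ beats T i j
aboveDiagonal-beats T i j with <-cmp i j
... | tri< _ _ _    = refl
... | tri≈ _ refl _ = sym (irreflexive T i)
... | tri> _ i≢j _  = sym (oneArc T i j i≢j)

upperArcs₅ : (Fin 5 → Fin 5 → Bool) → Vec Bool 10
upperArcs₅ B = B 0F 1F ∷ B 0F 2F ∷ B 0F 3F ∷ B 0F 4F ∷ B 1F 2F ∷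
               B 1F 3F ∷ B 1F 4F ∷ B 2F 3F ∷ B 2F 4F ∷ B 3F 4F ∷ []

fromUpperArcs₅ : Vec Bool 10 → Fin 5 → Fin 5 → Bool
fromUpperArcs₅ (a₀₁ ∷ _ ∷ _ ∷ _ ∷ _ ∷ _ ∷ _ ∷ _ ∷ _ ∷ _ ∷ []) 0F 1F = a₀₁
fromUpperArcs₅ (_ ∷ a₀₂ ∷ _ ∷ _ ∷ _ ∷ _ ∷ _ ∷ _ ∷ _ ∷ _ ∷ []) 0F 2F = a₀₂
fromUpperArcs₅ (_ ∷ _ ∷ a₀₃ ∷ _ ∷ _ ∷ _ ∷ _ ∷ _ ∷ _ ∷ _ ∷ []) 0F 3F = a₀₃
fromUpperArcs₅ (_ ∷ _ ∷ _ ∷ a₀₄ ∷ _ ∷ _ ∷ _ ∷ _ ∷ _ ∷ _ ∷ []) 0F 4F = a₀₄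
fromUpperArcs₅ (_ ∷ _ ∷ _ ∷ _ ∷ a₁₂ ∷ _ ∷ _ ∷ _ ∷ _ ∷ _ ∷ []) 1F 2F = a₁₂
fromUpperArcs₅ (_ ∷ _ ∷ _ ∷ _ ∷ _ ∷ a₁₃ ∷ _ ∷ _ ∷ _ ∷ _ ∷ []) 1F 3F = a₁₃
fromUpperArcs₅ (_ ∷ _ ∷ _ ∷ _ ∷ _ ∷ _ ∷ a₁₄ ∷ _ ∷ _ ∷ _ ∷ []) 1F 4F = a₁₄
fromUpperArcs₅ (_ ∷ _ ∷ _ ∷ _ ∷ _ ∷ _ ∷ _ ∷ a₂₃ ∷ _ ∷ _ ∷ []) 2F 3F = a₂₃
fromUpperArcs₅ (_ ∷ _ ∷ _ ∷ _ ∷ _ ∷ _ ∷ _ ∷ _ ∷ a₂₄ ∷ _ ∷ []) 2F 4F = a₂₄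
fromUpperArcs₅ (_ ∷ _ ∷ _ ∷ _ ∷ _ ∷ _ ∷ _ ∷ _ ∷ _ ∷ a₃₄ ∷ []) 3F 4F = a₃₄
fromUpperArcs₅ _ _ _ = false

allBoolVecs : ∀ n → (Vec Bool n → Bool) → Bool
allBoolVecs zero    p = p []
allBoolVecs (suc n) p = allBoolVecs n (p ∘ (true ∷_)) ∧ allBoolVecs n (p ∘ (false ∷_))

allBoolVecs-sound : ∀ n p → IsTrue (allBoolVecs n p) → ∀ v → IsTrue (p v)
allBoolVecs-sound zero    p all []          = all
allBoolVecs-sound (suc n) p all (true ∷ v)  =
  allBoolVecs-sound n _ (proj₁ (Equivalence.to T-∧ all)) v
allBoolVecs-sound (suc n) p all (false ∷ v) =
  allBoolVecs-sound n _ (proj₂ (Equivalence.to (T-∧ {allBoolVecs n (p ∘ (true ∷_))}) all)) v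

ZeroOrTwo : ℕ → Set
ZeroOrTwo c = c ≡ 0 ⊎ c ≡ 2

diamondsAmongFive-orient : ∀ arcs → ZeroOrTwo (∂ (diamond (orient (fromUpperArcs₅ arcs))) (allFin 5))
diamondsAmongFive-orient = toWitness ∘ allBoolVecs-sound 10 (isYes ∘ zeroOrTwo? ∘ count) tt
  where
  count : Vec Bool 10 → ℕ
  count arcs = ∂ (diamond (orient (fromUpperArcs₅ arcs))) (allFin 5)
  zeroOrTwo? : ∀ c → Dec (ZeroOrTwo c)
  zeroOrTwo? c = (c ≟ 0) ⊎-dec (c ≟ 2)

-- orient (fromUpperArcs₅ (upperArcs₅ B)) and orient B have definitionally equal arcs on Fin 5.
diamondsAmongFive : (T : Tournament 5) → ZeroOrTwo (∂ (diamond T) (allFin 5))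
diamondsAmongFive T =
  subst ZeroOrTwo (∂-cong (diamond-cong {T = orient (beats T)} {T} (aboveDiagonal-beats T)) (allFin 5))
        (diamondsAmongFive-orient (upperArcs₅ (beats T)))

diamondsAmongFive-Increasing : ∀ {m} (T : Tournament m) {u : Vec (Fin m) 5} → Increasing u → ZeroOrTwo (∂ (diamond T) u)
diamondsAmongFive-Increasing T {u@(_ ∷ _ ∷ _ ∷ _ ∷ _ ∷ [])} u↑ =
  diamondsAmongFive (induced T (lookup u) (Increasing⇒lookup-injective u↑))

-- Since a 5-set spans 0 or 2 diamonds, every diamond in it has a partner.
diamond-partner : ∀ {m} (T : Tournament m) {u : Vec (Fin m) 5} → Increasing u → ∀ i →
                  diamond T (removeAt u i) ≢ 0 → ∃[ j ] j ≢ i × diamond T (removeAt u j) ≢ 0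
diamond-partner T {u} u↑ i dᵢ≢0 with sum≢0⇒term≢0 (λ k → t (punchIn i k)) others≢0
  where
  t : Fin 5 → ℕ
  t j = diamond T (removeAt u j)
  ∂≡Σt : ∂ (diamond T) u ≡ sum t
  ∂≡Σt = ∂≡sum-removeAt (diamond T) u
  Σt≡2 : sum t ≡ 2
  Σt≡2 with diamondsAmongFive-Increasing T u↑
  ... | inj₁ ∂≡0 = contradiction (n≤0⇒n≡0 (≤-trans (term≤sum t i) (≤-reflexive (trans (sym ∂≡Σt) ∂≡0)))) dᵢ≢0
  ... | inj₂ ∂≡2 = trans (sym ∂≡Σt) ∂≡2
  others≢0 : sum (t ∘ punchIn i) ≢ 0
  others≢0 others≡0 = contradiction 2≤1 λ { (s≤s ()) }
    where
    open ≤-Reasoning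
    2≤1 : 2 ≤ 1
    2≤1 = begin
      2                          ≡⟨ Σt≡2 ⟨
      sum t                      ≡⟨ sum-remove t ⟩
      t i + sum (t ∘ punchIn i)  ≡⟨ cong (t i +_) others≡0 ⟩
      t i + 0                    ≡⟨ +-identityʳ (t i) ⟩
      t i                        ≤⟨ indicator≤1 _ ⟩
      1                          ∎
... | k , dₖ≢0 = punchIn i k , punchInᵢ≢i i k , dₖ≢0

diamond+δ∖≤δ : ∀ {m} (T : Tournament (suc m)) v {z} → Increasing z → v ∈ z → diamond T z + δ (T ∖ v) ≤ δ T
diamond+δ∖≤δ {m} T v {z} z↑ v∈z = begin
  diamond T z + δ (T ∖ v)
    ≡⟨ cong (diamond T z +_) (trans (δ≡subsetSum (T ∖ v))
                                    (subsetSum-cong 4 m (diamond-∖ T v))) ⟩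
  diamond T z + subsetSum 4 m (diamond T ∘ map (punchIn v))
    ≤⟨ term+subsetSum-punchIn≤ 4 m v (diamond T) z↑ v∈z ⟩
  subsetSum 4 (suc m) (diamond T)
    ≡⟨ δ≡subsetSum T ⟨
  δ T ∎
  where open ≤-Reasoning

-- w survives in T ∖ v, while its partner in the 5-set w ∪ {v} contains v.
deletion-outside-diamond : ∀ {m} (T : Tournament (suc m)) → 4 ≤ m → ∀ {w} → Increasing w → diamond T w ≢ 0 →
                           ∃[ v ] δ (T ∖ v) ≢ 0 × suc (δ (T ∖ v)) ≤ δ T
deletion-outside-diamond {m} T 4≤m {w} w↑ w◆ =
  vertex , δ∖≢0 , partner⇒δ∖<δ (diamond-partner T extended↑ position w◆′)
  where
  open Extension (extend w↑ 4≤m)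
  u = insertAt w position vertex
  w◆′ : diamond T (removeAt u position) ≢ 0
  w◆′ = subst (λ x → diamond T x ≢ 0) (sym (removeAt-insertAt w position vertex)) w◆
  partner⇒δ∖<δ : (∃[ j ] j ≢ position × diamond T (removeAt u j) ≢ 0) → suc (δ (T ∖ vertex)) ≤ δ T
  partner⇒δ∖<δ (j , j≢position , z◆) =
    ≤-trans (+-monoˡ-≤ (δ (T ∖ vertex)) (n≢0⇒n>0 z◆))
            (diamond+δ∖≤δ T vertex (Increasing-removeAt extended↑ j) vertex∈z)
    where
    vertex∈z : vertex ∈ removeAt u j
    vertex∈z = subst (_∈ removeAt u j) (insertAt-lookup w position vertex) (lookup∈removeAt u (j≢position ∘ sym))
  δ∖≢0 : δ (T ∖ vertex) ≢ 0
  δ∖≢0 δ∖≡0 = w◆ (n≤0⇒n≡0 (begin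
    diamond T w                            ≡⟨ cong (diamond T) renumber ⟨
    diamond T (map (punchIn vertex) rest)  ≡⟨ diamond-∖ T vertex rest ⟨
    diamond (T ∖ vertex) rest              ≤⟨ term≤subsetSum (diamond (T ∖ vertex)) rest↑ ⟩
    subsetSum 4 m (diamond (T ∖ vertex))   ≡⟨ δ≡subsetSum (T ∖ vertex) ⟨
    δ (T ∖ vertex)                         ≡⟨ δ∖≡0 ⟩
    0                                      ∎))
    where open ≤-Reasoning

lowerBound : ∀ n (T : Tournament n) → δ T ≢ 0 → n ∸ 3 ≤ δ T
lowerBound zero    T δ≢0 = z≤n
lowerBound (suc m) T δ≢0 with 4 ≤? m
... | no 4≰m = ≤-trans (∸-monoˡ-≤ 3 (≰⇒> 4≰m)) (n≢0⇒n>0 δ≢0)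
... | yes 4≤m with subsetSum≢0⇒term≢0 4 (suc m) (diamond T) (δ≢0 ∘ trans (δ≡subsetSum T))
...   | w , w↑ , w◆ with deletion-outside-diamond T 4≤m w↑ w◆
...     | v , δ∖≢0 , δ∖<δ = begin
  suc m ∸ 3        ≡⟨ +-∸-assoc 1 (≤-trans (n≤1+n 3) 4≤m) ⟩
  suc (m ∸ 3)      ≤⟨ s≤s (lowerBound m (T ∖ v) δ∖≢0) ⟩
  suc (δ (T ∖ v))  ≤⟨ δ∖<δ ⟩
  δ T              ∎
  where open ≤-Reasoning

upperBound-scaled : ∀ n (T : Tournament n) → (n ∸ 4) * (5 * δ T) ≤ (n ∸ 4) * (2 * (n C 4))
upperBound-scaled n T = begin
  (n ∸ 4) * (5 * δ T)                ≡⟨ m*[n*o]≡n*[m*o] (n ∸ 4) 5 (δ T) ⟩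
  5 * ((n ∸ 4) * δ T)                ≡⟨ cong (λ d → 5 * ((n ∸ 4) * d)) (δ≡subsetSum T) ⟩
  5 * ((n ∸ 4) * subsetSum 4 n (diamond T)) ≡⟨ cong (5 *_) (subsetSum-∂ 4 n (diamond T)) ⟨
  5 * subsetSum 5 n (∂ (diamond T))  ≤⟨ *-monoʳ-≤ 5 (subsetSum-mono 5 n (≤2 ∘ diamondsAmongFive-Increasing T)) ⟩
  5 * subsetSum 5 n (λ _ → 2)        ≡⟨ cong (5 *_) (subsetSum-const 5 n 2) ⟩
  5 * (2 * (n C 5))                  ≡⟨ m*[n*o]≡n*[m*o] 5 2 (n C 5) ⟩
  2 * (5 * (n C 5))                  ≡⟨ cong (2 *_) (binomial-absorption n 4) ⟨
  2 * ((n ∸ 4) * (n C 4))            ≡⟨ m*[n*o]≡n*[m*o] 2 (n ∸ 4) (n C 4) ⟩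
  (n ∸ 4) * (2 * (n C 4))            ∎
  where
  open ≤-Reasoning
  ≤2 : ∀ {c} → ZeroOrTwo c → c ≤ 2
  ≤2 (inj₁ refl) = z≤n
  ≤2 (inj₂ refl) = ≤-refl

upperBound : ∀ n → 5 ≤ n → (T : Tournament n) → 5 * δ T ≤ 2 * (n C 4)
upperBound n 5≤n T = *-cancelˡ-≤ (n ∸ 4) {{>-nonZero (m<n⇒0<n∸m 5≤n)}} (upperBound-scaled n T)

lemma2p5 : (n : ℕ) → 5 ≤ n → (T : Tournament n) →
    δ T ≡ 0 ⊎ (n ∸ 3 ≤ δ T × 5 * δ T ≤ 2 * (n C 4))
lemma2p5 n 5≤n T with δ T ≟ 0
... | yes δ≡0 = inj₁ δ≡0
... | no  δ≢0 = inj₂ (lowerBound n T δ≢0 , upperBound n 5≤n T)
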